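{- Let $U,V$ be ultrafilters on countable sets and suppose $V\cdot V\equiv_T V$. Then $U\cdot V\equiv_T U\times V$. Moreover, if also $U\cdot U\equiv_T U$, then $U\cdot V\equiv_T V\cdot U$.
   Context: For filters $U$ on $X$, $V$ on $Y$, $U\cdot V$ is the filter on $X\times Y$ with $A\in U\cdot V$ iff $\{x:\{y:(x,y)\in A\}\in V\}\in U$. Ultrafilters are ordered by $\supseteq$; $U\times V$ is the product poset with the coordinatewise order. $P\le_TQ$ means there is $f:Q\to P$ mapping cofinal subsets of $Q$ to cofinal subsets of $P$; $\equiv_T$ is two-way $\le_T$. -}

module Defs where

import Level
open Level using (0ℓ)
open import Data.Nat using (ℕ)
open import Data.Product using (Σ; ∃; _×_; _,_; proj₁; proj₂)
open import Data.Sum using (_⊎_)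
open import Data.Empty using (⊥)
open import Relation.Nullary using (¬_)
open import Relation.Binary.PropositionalEquality using (_≡_)
open import Relation.Unary using (Pred; _⊆_; ∁; _∩_; U)
open import Function.Definitions using (Injective)

Countable : Set → Set
Countable X = Σ (X → ℕ) λ f → Injective _≡_ _≡_ f

Subset : Set → Set₁
Subset X = Pred X 0ℓ

Family : Set → Set₁
Family X = Subset X → Set

record IsUltrafilter {X : Set} (F : Family X) : Set₁ where
  field
    whole   : F U
    proper  : ¬ F (λ _ → ⊥)
    upward  : ∀ {A B : Subset X} → A ⊆ B → F A → F B
    meet    : ∀ {A B : Subset X} → F A → F B → F (A ∩ B)
    ultra   : ∀ (A : Subset X) → F A ⊎ F (∁ A)

_·_ : {X Y : Set} → Family X → Family Y → Family (X × Y)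
(F · G) A = F (λ x → G (λ y → A (x , y)))

record Preorder : Set₂ where
  field
    Car : Set₁
    _≤_ : Car → Car → Set

UltPoset : {X : Set} → Family X → Preorder
UltPoset {X} F = record
  { Car = Σ (Subset X) F
  ; _≤_ = λ A B → proj₁ B ⊆ proj₁ A }

_⊗_ : Preorder → Preorder → Preorder
P ⊗ Q = record
  { Car = Preorder.Car P × Preorder.Car Q
  ; _≤_ = λ a b → Preorder._≤_ P (proj₁ a) (proj₁ b) × Preorder._≤_ Q (proj₂ a) (proj₂ b) }

Cofinal : (P : Preorder) → Pred (Preorder.Car P) (Level.suc 0ℓ) → Set₁
Cofinal P C = ∀ (p : Preorder.Car P) → ∃ λ c → C c × Preorder._≤_ P p c

Image : {A B : Set₁} → (A → B) → Pred A (Level.suc 0ℓ) → Pred B (Level.suc 0ℓ)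
Image f C b = ∃ λ a → C a × f a ≡ b

_≤T_ : Preorder → Preorder → Set₂
P ≤T Q = Σ (Preorder.Car Q → Preorder.Car P) λ f →
  ∀ (C : Pred (Preorder.Car Q) (Level.suc 0ℓ)) → Cofinal Q C → Cofinal P (Image f C)

_≡T_ : Preorder → Preorder → Set₂
P ≡T Q = (P ≤T Q) × (Q ≤T P)

{-# OPTIONS --safe #-}
-- U ⊗ V ≤T U · V via the two projections of a Fubini-large set. Conversely
-- U · V ≤T U ⊗ (V · V) ≤T U ⊗ V, where (S , A) is sent to the set of (x , y)
-- with x ∈ S and (z , y) ∈ A for some z of index ≥ index x (or z the principal
-- point of V). For C ∈ U · V, everything below S₀ = {x ∣ Cₓ ∈ V, and Cₓ
-- contains the principal point of V if there is one} and
-- A₀ = {(z , y) ∣ y ∈ Cₓ for all x ∈ S₀ of index ≤ index z} is sent into C, and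
-- A₀ ∈ V · V because each of its sections is a finite intersection of members
-- of V. The second claim follows by symmetry of ⊗. Ultrafilter membership is
-- ¬¬-stable, which licenses the classical case distinctions.
module Submission where

open import Defs
open import Data.Nat using (ℕ; zero; suc; _≤_; _<_; s≤s)
open import Data.Nat.Properties using (_≟_; ≰⇒>; m<1+n⇒m<n∨m≡n)
open import Data.Product using (_×_; ∃; _,_; proj₁; proj₂)
open import Data.Sum using (_⊎_; inj₁; inj₂)
open import Data.Empty using (⊥-elim)
open import Relation.Nullary using (¬_; yes; no)
open import Relation.Nullary.Decidable using (map′; decidable-stable; ¬¬-excluded-middle)
open import Relation.Nullary.Negation using (Stable; ¬¬-map)
open import Relation.Binary.PropositionalEquality using (_≡_; refl; sym; trans; cong; subst)
open import Function.Definitions using (Injective)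

Convergent : (P Q : Preorder) → (Preorder.Car Q → Preorder.Car P) → Set₁
Convergent P Q h =
  ∀ p → ∃ λ q₀ → ∀ q → Preorder._≤_ Q q₀ q → Preorder._≤_ P p (h q)

convergent⇒≤T : (P Q : Preorder) (h : Preorder.Car Q → Preorder.Car P) →
  Convergent P Q h → P ≤T Q
convergent⇒≤T P Q h conv = h , λ C cofinal p →
  let (q₀ , above) = conv p
      (c , c∈C , q₀≤c) = cofinal q₀
  in h c , (c , c∈C , refl) , above c q₀≤c

≤T-trans : {P Q R : Preorder} → P ≤T Q → Q ≤T R → P ≤T R
≤T-trans (f , f-cofinal) (g , g-cofinal) = (λ r → f (g r)) , λ C cofinal p →
  let (b , (_ , (a , a∈C , ga≡) , fga≡b) , p≤b) = f-cofinal _ (g-cofinal C cofinal) p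
  in b , (a , a∈C , trans (cong f ga≡) fga≡b) , p≤b

≡T-trans : {P Q R : Preorder} → P ≡T Q → Q ≡T R → P ≡T R
≡T-trans {P} {Q} {R} (P≤Q , Q≤P) (Q≤R , R≤Q) =
  ≤T-trans {P} {Q} {R} P≤Q Q≤R , ≤T-trans {R} {Q} {P} R≤Q Q≤P

≡T-sym : {P Q : Preorder} → P ≡T Q → Q ≡T P
≡T-sym (P≤Q , Q≤P) = Q≤P , P≤Q

-- The cofinal set of R ⊗ Q is shrunk to those second coordinates that occur
-- above a fixed first coordinate, which is still cofinal in Q.
⊗-monoʳ-≤T : {P Q : Preorder} (R : Preorder) → P ≤T Q → (R ⊗ P) ≤T (R ⊗ Q)
⊗-monoʳ-≤T {P} {Q} R (f , f-cofinal) = (λ (r , q) → r , f q) , λ C cofinal (r₀ , p) →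
  let C↾r₀ = λ q → ∃ λ r → C (r , q) × Preorder._≤_ R r₀ r
      C↾r₀-cofinal : Cofinal Q C↾r₀
      C↾r₀-cofinal q₀ = let ((r , q) , rq∈C , r₀≤r , q₀≤q) = cofinal (r₀ , q₀)
                        in q , (r , rq∈C , r₀≤r) , q₀≤q
      (_ , (q , (r , rq∈C , r₀≤r) , fq≡) , p≤) = f-cofinal C↾r₀ C↾r₀-cofinal p
  in (r , f q) , ((r , q) , rq∈C , refl) , r₀≤r , subst (Preorder._≤_ P p) (sym fq≡) p≤

⊗-comm-≡T : (P Q : Preorder) → (P ⊗ Q) ≡T (Q ⊗ P)
⊗-comm-≡T P Q = swap-≤T P Q , swap-≤T Q P
  where
  swap-≤T : (P Q : Preorder) → (P ⊗ Q) ≤T (Q ⊗ P)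
  swap-≤T P Q = convergent⇒≤T (P ⊗ Q) (Q ⊗ P) (λ (q , p) → p , q)
    λ (p , q) → (q , p) , λ _ (q≤ , p≤) → p≤ , q≤

module UltrafilterProperties {X : Set} {F : Family X} (uF : IsUltrafilter F) where
  open IsUltrafilter uF

  ∈-stable : ∀ {A} → Stable (F A)
  ∈-stable {A} ¬¬a with ultra A
  ... | inj₁ a = a
  ... | inj₂ ∁a = ⊥-elim (¬¬a λ a → proper (upward (λ (ax , ∁ax) → ∁ax ax) (meet a ∁a)))

  ∈-from-¬¬ : ∀ {ℓ} {P : Set ℓ} {A} → ¬ ¬ P → (P → F A) → F A
  ∈-from-¬¬ ¬¬p p⇒a = ∈-stable (¬¬-map p⇒a ¬¬p)

  ∈-byCases : ∀ {ℓ} {P : Set ℓ} {A} → (P → F A) → (¬ P → F A) → F A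
  ∈-byCases p⇒a ¬p⇒a = ∈-from-¬¬ ¬¬-excluded-middle λ
    { (yes p) → p⇒a p
    ; (no ¬p) → ¬p⇒a ¬p }

  nonempty : ∀ {A} → F A → ¬ ¬ ∃ A
  nonempty a ∄ = proper (upward (λ {x} ax → ∄ (x , ax)) a)

  upward-¬¬ : ∀ {S T} → F S → (∀ {x} → S x → ¬ ¬ T x) → F T
  upward-¬¬ {T = T} s S⇒¬¬T with ultra T
  ... | inj₁ t = t
  ... | inj₂ ∁t = ⊥-elim (proper (upward (λ (sx , ¬tx) → S⇒¬¬T sx ¬tx) (meet s ∁t)))

  PrincipalAt : X → Set
  PrincipalAt z = F (_≡ z)

  principalAt-∈ : ∀ {z A} → PrincipalAt z → F A → ¬ ¬ A z
  principalAt-∈ {A = A} p a = ¬¬-map (λ (_ , y≡z , ay) → subst A y≡z ay) (nonempty (meet p a))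

  at-principal-∈ : ∀ z → F (λ y → PrincipalAt z → y ≡ z)
  at-principal-∈ z = ∈-byCases
    (λ p → upward (λ y≡z _ → y≡z) p)
    (λ ¬p → upward (λ _ p → ⊥-elim (¬p p)) whole)

module FubiniProperties {X Y : Set} {F : Family X} {G : Family Y}
  (uF : IsUltrafilter F) (uG : IsUltrafilter G) where
  private
    module F = IsUltrafilter uF
    module G = IsUltrafilter uG
    module FP = UltrafilterProperties uF
    module GP = UltrafilterProperties uG

  ·-projˣ : ∀ {A} → (F · G) A → F (λ x → ∃ λ y → A (x , y))
  ·-projˣ a = FP.upward-¬¬ a GP.nonempty

  ·-projʸ : ∀ {A} → (F · G) A → G (λ y → ∃ λ x → A (x , y))
  ·-projʸ a = GP.∈-from-¬¬ (FP.nonempty a) λ (x , ax) → G.upward (λ ay → x , ay) ax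

  ·-restrictˣ : ∀ {P A} → F P → (F · G) A → (F · G) (λ (x , y) → P x × A (x , y))
  ·-restrictˣ p a = F.upward (λ (px , ax) → G.upward (px ,_) ax) (F.meet p a)

  ⊗≤T-· : (UltPoset F ⊗ UltPoset G) ≤T UltPoset (F · G)
  ⊗≤T-· = convergent⇒≤T (UltPoset F ⊗ UltPoset G) (UltPoset (F · G))
    (λ (A , a) → ((λ x → ∃ λ y → A (x , y)) , ·-projˣ a) , ((λ y → ∃ λ x → A (x , y)) , ·-projʸ a))
    λ ((S , s) , (T , t)) →
      ((λ (x , y) → S x × T y) , F.upward (λ sx → G.upward (sx ,_) t) s) ,
      λ _ ⊆S×T → (λ (_ , a) → proj₁ (⊆S×T a)) , (λ (_ , a) → proj₂ (⊆S×T a))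

module CountableIntersections {X Y : Set} (ix : X → ℕ) (ix-injective : Injective _≡_ _≡_ ix)
  {G : Family Y} (uG : IsUltrafilter G) where
  open IsUltrafilter uG
  open UltrafilterProperties uG

  bounded-⋂-∈ : ∀ {S : X → Set} {B : X → Y → Set} → (∀ {x} → S x → G (B x)) →
    ∀ m → G (λ y → ∀ {x} → S x → ix x < m → B x y)
  bounded-⋂-∈ b zero = upward (λ {_} _ {_} _ ()) whole
  bounded-⋂-∈ {S} {B} b (suc m) = upward split (meet (level-∈ m) (bounded-⋂-∈ b m))
    where
    level-∈ : ∀ m → G (λ y → ∀ {x} → S x → ix x ≡ m → B x y)
    level-∈ m = ∈-byCases
      (λ (x₀ , sx₀ , ix₀≡m) → upward
        (λ {y} bx₀y {x} _ ix≡m → subst (λ x → B x y) (ix-injective (trans ix₀≡m (sym ix≡m))) bx₀y)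
        (b sx₀))
      (λ ∄ → upward (λ {_} _ {x} sx ix≡m → ⊥-elim (∄ (x , sx , ix≡m))) whole)
    split : ∀ {y} → (∀ {x} → S x → ix x ≡ m → B x y) × (∀ {x} → S x → ix x < m → B x y) →
      ∀ {x} → S x → ix x < suc m → B x y
    split (at-m , below-m) {x} sx ix<1+m with m<1+n⇒m<n∨m≡n ix<1+m
    ... | inj₁ ix<m = below-m sx ix<m
    ... | inj₂ ix≡m = at-m sx ix≡m

module CountableUltrafilter {Y : Set} (iy : Y → ℕ) (iy-injective : Injective _≡_ _≡_ iy)
  {G : Family Y} (uG : IsUltrafilter G) where
  open IsUltrafilter uG
  open UltrafilterProperties uG

  principalAt-unique : ∀ {z z′} → PrincipalAt z → PrincipalAt z′ → z ≡ z′
  principalAt-unique {z} {z′} p p′ =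
    decidable-stable (map′ iy-injective (cong iy) (iy z ≟ iy z′))
      (¬¬-map (λ (_ , y≡z , y≡z′) → trans (sym y≡z) y≡z′) (nonempty (meet p p′)))

  ∈⇒principal-¬¬ : ∀ {A} → G A → ¬ ¬ (∀ {z} → PrincipalAt z → A z)
  ∈⇒principal-¬¬ {A} a k = ¬¬-excluded-middle {A = ∃ PrincipalAt} λ
    { (yes (z₀ , p₀)) → principalAt-∈ p₀ a λ az₀ →
        k (λ p → subst A (principalAt-unique p₀ p) az₀)
    ; (no ∄) → k (λ p → ⊥-elim (∄ (_ , p))) }

  below-∉ : ¬ ∃ PrincipalAt → ∀ n → ¬ G (λ y → iy y < n)
  below-∉ ∄ zero g = proper (upward (λ ()) g)
  below-∉ ∄ (suc n) g with ultra (λ y → iy y ≡ n)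
  ... | inj₁ ≡n = nonempty ≡n λ (z , iz≡n) →
    ∄ (z , upward (λ iy≡n → iy-injective (trans iy≡n (sym iz≡n))) ≡n)
  ... | inj₂ ≢n = below-∉ ∄ n (upward narrow (meet g ≢n))
    where
    narrow : ∀ {y} → iy y < suc n × ¬ iy y ≡ n → iy y < n
    narrow (iy<1+n , iy≢n) with m<1+n⇒m<n∨m≡n iy<1+n
    ... | inj₁ iy<n = iy<n
    ... | inj₂ iy≡n = ⊥-elim (iy≢n iy≡n)

  above-∈ : ¬ ∃ PrincipalAt → ∀ n → G (λ y → n ≤ iy y)
  above-∈ ∄ n with ultra (λ y → n ≤ iy y)
  ... | inj₁ above = above
  ... | inj₂ ¬above = ⊥-elim (below-∉ ∄ n (upward ≰⇒> ¬above))

  Large : ℕ → Y → Set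
  Large n z = n ≤ iy z ⊎ PrincipalAt z

  large-∈ : ∀ n → G (Large n)
  large-∈ n = ∈-byCases
    (λ (z , p) → upward (λ y≡z → inj₂ (subst PrincipalAt (sym y≡z) p)) p)
    (λ ∄ → upward inj₁ (above-∈ ∄ n))

module FubiniViaSquare {X Y : Set} (ix : X → ℕ) (ix-injective : Injective _≡_ _≡_ ix)
  (iy : Y → ℕ) (iy-injective : Injective _≡_ _≡_ iy)
  {F : Family X} {G : Family Y} (uF : IsUltrafilter F) (uG : IsUltrafilter G) where
  private
    module F = IsUltrafilter uF
    module G = IsUltrafilter uG
    module FP = UltrafilterProperties uF
    module GP = UltrafilterProperties uG
  open CountableUltrafilter iy iy-injective uG
  open CountableIntersections ix ix-injective uG
  open FubiniProperties uG uG

  section : X → (Y × Y → Set) → Y → Set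
  section x A y = ∃ λ z → Large (ix x) z × A (z , y)

  section-∈ : ∀ x {A} → (G · G) A → G (section x A)
  section-∈ x a = ·-projʸ (·-restrictˣ (large-∈ (ix x)) a)

  fromSquare : Preorder.Car (UltPoset F ⊗ UltPoset (G · G)) → Preorder.Car (UltPoset (F · G))
  fromSquare ((S , s) , (A , a)) =
    (λ (x , y) → S x × section x A y) , F.upward (λ {x} sx → G.upward (sx ,_) (section-∈ x a)) s

  module _ {C : X × Y → Set} (c : (F · G) C) where
    S₀ : X → Set
    S₀ x = G (λ y → C (x , y)) × (∀ {z} → GP.PrincipalAt z → C (x , z))

    A₀ : Y × Y → Set
    A₀ (z , y) = ∀ x → S₀ x → Large (ix x) z → C (x , y)

    s₀ : F S₀
    s₀ = FP.upward-¬¬ c λ cx → ¬¬-map (cx ,_) (∈⇒principal-¬¬ cx)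

    -- For fixed z, only the finitely many x of index at most iy z constrain y,
    -- unless z is the principal point.
    a₀ : (G · G) A₀
    a₀ = G.upward (λ {z} _ → G.upward (λ (below , at) → A₀-from below at)
                    (G.meet (bounded-⋂-∈ proj₁ (suc (iy z))) (GP.at-principal-∈ z))) G.whole
      where
      A₀-from : ∀ {z y} → (∀ {x} → S₀ x → ix x < suc (iy z) → C (x , y)) →
        (GP.PrincipalAt z → y ≡ z) → A₀ (z , y)
      A₀-from below at _ sx (inj₁ ix≤iz) = below sx (s≤s ix≤iz)
      A₀-from below at x sx (inj₂ p) = subst (λ w → C (x , w)) (sym (at p)) (proj₂ sx p)

  fromSquare-convergent : Convergent (UltPoset (F · G)) (UltPoset F ⊗ UltPoset (G · G)) fromSquare
  fromSquare-convergent (C , c) = ((S₀ c , s₀ c) , (A₀ c , a₀ c)) ,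
    λ _ (S⊆S₀ , A⊆A₀) (sx , _ , large , a) → A⊆A₀ a _ (S⊆S₀ sx) large

  ·≤T-⊗-square : UltPoset (F · G) ≤T (UltPoset F ⊗ UltPoset (G · G))
  ·≤T-⊗-square = convergent⇒≤T _ _ fromSquare fromSquare-convergent

·-≡T-⊗ : {X Y : Set} → Countable X → Countable Y →
  (F : Family X) → (G : Family Y) → IsUltrafilter F → IsUltrafilter G →
  UltPoset (G · G) ≤T UltPoset G → UltPoset (F · G) ≡T (UltPoset F ⊗ UltPoset G)
·-≡T-⊗ (ix , ix-injective) (iy , iy-injective) F G uF uG G·G≤G =
  ≤T-trans {UltPoset (F · G)} {UltPoset F ⊗ UltPoset (G · G)} {UltPoset F ⊗ UltPoset G}
    (FubiniViaSquare.·≤T-⊗-square ix ix-injective iy iy-injective uF uG)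
    (⊗-monoʳ-≤T {UltPoset (G · G)} {UltPoset G} (UltPoset F) G·G≤G) ,
  FubiniProperties.⊗≤T-· uF uG

corollary1p9 : {X Y : Set} → Countable X → Countable Y →
    (F : Family X) → (G : Family Y) → IsUltrafilter F → IsUltrafilter G →
    UltPoset (G · G) ≡T UltPoset G →
    (UltPoset (F · G) ≡T (UltPoset F ⊗ UltPoset G))
    × (UltPoset (F · F) ≡T UltPoset F → UltPoset (F · G) ≡T UltPoset (G · F))
corollary1p9 cX cY F G uF uG (G·G≤G , _) =
  U·V≡U⊗V , λ (F·F≤F , _) →
    ≡T-trans {UltPoset (F · G)} {UltPoset F ⊗ UltPoset G} {UltPoset (G · F)} U·V≡U⊗V
      (≡T-trans {UltPoset F ⊗ UltPoset G} {UltPoset G ⊗ UltPoset F} {UltPoset (G · F)}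
        (⊗-comm-≡T (UltPoset F) (UltPoset G))
        (≡T-sym {UltPoset (G · F)} {UltPoset G ⊗ UltPoset F} (·-≡T-⊗ cY cX G F uG uF F·F≤F)))
  where
  U·V≡U⊗V : UltPoset (F · G) ≡T (UltPoset F ⊗ UltPoset G)
  U·V≡U⊗V = ·-≡T-⊗ cX cY F G uF uG G·G≤G
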